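{- Let $t$ be any variable-free term of the language $\{e,\vdash,\circ\}$, and let $s$ be the sequence which is the interpretation of $t$ in the standard model $\mathfrak{S}$. Then $t=\overline{s}$ is provable from the axiom scheme $\mathsf{WSeq}_2$.
   Context: Language $\{e,\ \vdash,\ \circ\}$: $e$ constant, $\vdash$ and $\circ$ binary function symbols ($x\vdash y$ is a term, not provability). Sequences: $()$ is a sequence, and if $s_1,\dots,s_n$ ($n>0$) are sequences then $(s_1,\dots,s_n)$ is a sequence. The standard model $\mathfrak{S}$ has universe all sequences, $e^{\mathfrak S}=()$, $(s_1,\dots,s_n)\vdash^{\mathfrak S}t=(s_1,\dots,s_n,t)$, and $\circ^{\mathfrak S}$ is concatenation. The sequeral $\overline{s}$ is the closed term with $\overline{()}=e$ and $\overline{(s_1,\dots,s_n)}=(\cdots((e\vdash\overline{s_1})\vdash\overline{s_2})\cdots)\vdash\overline{s_n}$. The axiom scheme $\mathsf{WSeq}_2$ consists of all sentences $\overline{(s_1,\dots,s_n)}\circ\overline{(t_1,\dots,t_m)}=\overline{(s_1,\dots,s_n,t_1,\dots,t_m)}$ for sequences $(s_1,\dots,s_n)$ and $(t_1,\dots,t_m)$. -}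

module Defs where

open import Data.List using (List; []; _∷_; _++_; [_])

data Seq : Set where
  seq : List Seq → Seq

elems : Seq → List Seq
elems (seq xs) = xs

infixl 6 _⊢_
infixl 5 _∘_
data Term : Set where
  e   : Term
  _⊢_ : Term → Term → Term
  _∘_ : Term → Term → Term

⟦_⟧ : Term → Seq
⟦ e ⟧     = seq []
⟦ t ⊢ u ⟧ = seq (elems ⟦ t ⟧ ++ [ ⟦ u ⟧ ])
⟦ t ∘ u ⟧ = seq (elems ⟦ t ⟧ ++ elems ⟦ u ⟧)

-- Sequerals: overline (s₁,…,sₙ) = (⋯((e ⊢ s̄₁) ⊢ s̄₂)⋯) ⊢ s̄ₙ.
mutual
  num : Seq → Term
  num (seq xs) = numFrom e xs

  numFrom : Term → List Seq → Term
  numFrom acc []       = acc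
  numFrom acc (x ∷ xs) = numFrom (acc ⊢ num x) xs

data WSeq₂ : Term → Term → Set where
  wseq : (ss ts : List Seq) → WSeq₂ (num (seq ss) ∘ num (seq ts)) (num (seq (ss ++ ts)))

infix 4 WSeq₂⊢_≐_
data WSeq₂⊢_≐_ : Term → Term → Set where
  ax     : ∀ {t u} → WSeq₂ t u → WSeq₂⊢ t ≐ u
  refl   : ∀ {t} → WSeq₂⊢ t ≐ t
  sym    : ∀ {t u} → WSeq₂⊢ t ≐ u → WSeq₂⊢ u ≐ t
  trans  : ∀ {t u v} → WSeq₂⊢ t ≐ u → WSeq₂⊢ u ≐ v → WSeq₂⊢ t ≐ v
  cong-⊢ : ∀ {t t′ u u′} → WSeq₂⊢ t ≐ t′ → WSeq₂⊢ u ≐ u′ → WSeq₂⊢ t ⊢ u ≐ t′ ⊢ u′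
  cong-∘ : ∀ {t t′ u u′} → WSeq₂⊢ t ≐ t′ → WSeq₂⊢ u ≐ u′ → WSeq₂⊢ t ∘ u ≐ t′ ∘ u′

-- For t ⊢ u, appending one element to a sequence appends one
-- ⊢-step to its sequeral, so no axiom is needed; for t ∘ u, the induction
-- hypotheses reduce t ∘ u to a concatenation of two sequerals, which is an
-- instance of WSeq₂.
module Submission where

open import Defs
open import Data.List using (List; []; _∷_; _++_; [_])
open import Relation.Binary.PropositionalEquality as ≡ using (_≡_)

numFrom-++-[_] : ∀ acc (xs : List Seq) v → numFrom acc (xs ++ [ v ]) ≡ numFrom acc xs ⊢ num v
numFrom-++-[ acc ] []       v = ≡.refl
numFrom-++-[ acc ] (x ∷ xs) v = numFrom-++-[ acc ⊢ num x ] xs v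

num-η : ∀ s → num (seq (elems s)) ≡ num s
num-η (seq xs) = ≡.refl

≡⇒provable : ∀ {t u} → t ≡ u → WSeq₂⊢ t ≐ u
≡⇒provable ≡.refl = refl

-- Stated with seq (elems ⟦ t ⟧) rather than ⟦ t ⟧ so that num reduces on the
-- right-hand side even for a variable t.
provable-num-elems : (t : Term) → WSeq₂⊢ t ≐ num (seq (elems ⟦ t ⟧))
provable-num-elems e       = refl
provable-num-elems (t ⊢ u) =
  trans (cong-⊢ (provable-num-elems t) (trans (provable-num-elems u) (≡⇒provable (num-η ⟦ u ⟧))))
        (≡⇒provable (≡.sym (numFrom-++-[ e ] (elems ⟦ t ⟧) ⟦ u ⟧)))
provable-num-elems (t ∘ u) =
  trans (cong-∘ (provable-num-elems t) (provable-num-elems u))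
        (ax (wseq (elems ⟦ t ⟧) (elems ⟦ u ⟧)))

lemma1 : (t : Term) → WSeq₂⊢ t ≐ num ⟦ t ⟧
lemma1 t = trans (provable-num-elems t) (≡⇒provable (num-η ⟦ t ⟧))
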